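{- $M_n$ is a noncommutative monoid under matrix multiplication with identity $\mathbf{1}=\langle 0,1,n\rangle$. For any two nonzero elements $\langle d,k,m\rangle$, $\langle d',k',m'\rangle$ of $M_n$, set $$d''=d+d',\qquad k''=\max(k,k'-d),\qquad m''=\min(m,m'-d).$$ Then $\langle d,k,m\rangle\langle d',k',m'\rangle=\langle d'',k'',m''\rangle$ if $k''\le m''$, and $\langle d,k,m\rangle\langle d',k',m'\rangle=\mathbf{0}$ if $k''>m''$. Moreover, irrespective of whether $k''\le m''$ or not, $$1-\min(0,d'')\le k''\quad\text{and}\quad m''\le n-\max(0,d'').$$
   Context: Fix an integer $n\ge 2$. For integers $d,k,m$ with $1-\min(0,d)\le k\le m\le n-\max(0,d)$, let $\langle d,k,m\rangle$ denote the $n\times n$ matrix with entries $x_{ij}$ ($i,j\in\{1,\dots,n\}$) equal to $1$ if $k\le i\le m$ and $j-i=d$, and $0$ otherwise (its ones lie on the $d$-th diagonal, $d=0$ the main diagonal, $d>0$ above, $d<0$ below, in rows $k$ to $m$, forming an uninterrupted block of $m-k+1$ ones). Distinct admissible triples give distinct matrices. Let $\mathbf{0}$ be the $n\times n$ zero matrix and $M_n=\{\mathbf{0}\}\cup\{\langle d,k,m\rangle: d\in\mathbb{Z},\ k,m\in\mathbb{N},\ 1-\min(0,d)\le k\le m\le n-\max(0,d)\}$, with matrix multiplication. -}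

module Defs where

open import Data.Nat as ℕ using (ℕ; zero; suc)
open import Data.Integer as ℤ using (ℤ; +_; _-_; _⊓_; _⊔_; _≤_; _<_; _≤?_; _≟_)
open import Data.Fin using (Fin; toℕ)
import Data.Fin as Fin
open import Data.Bool using (if_then_else_; _∧_)
open import Data.Product using (Σ; _×_; _,_)
open import Data.Sum using (_⊎_)
open import Relation.Nullary.Decidable using (⌊_⌋)
open import Relation.Binary.PropositionalEquality using (_≡_)

-- n × n matrices with natural-number entries; entry (i , j) for i j : Fin n
-- corresponds to row i+1, column j+1 (rows/columns numbered 1..n).
Mat : ℕ → Set
Mat n = Fin n → Fin n → ℕ

sumFin : (n : ℕ) → (Fin n → ℕ) → ℕ
sumFin zero    f = 0
sumFin (suc n) f = f Fin.zero ℕ.+ sumFin n (λ i → f (Fin.suc i))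

_⊗_ : {n : ℕ} → Mat n → Mat n → Mat n
_⊗_ {n} A B i j = sumFin n (λ l → A i l ℕ.* B l j)

_≈_ : {n : ℕ} → Mat n → Mat n → Set
A ≈ B = ∀ i j → A i j ≡ B i j

𝟘 : {n : ℕ} → Mat n
𝟘 i j = 0

idx : {n : ℕ} → Fin n → ℤ
idx i = + suc (toℕ i)

⟨_,_,_⟩ : {n : ℕ} → ℤ → ℤ → ℤ → Mat n
⟨ d , k , m ⟩ i j =
  if ⌊ k ≤? idx i ⌋ ∧ ⌊ idx i ≤? m ⌋ ∧ ⌊ (idx j - idx i) ≟ d ⌋ then 1 else 0

Admissible : ℕ → ℤ → ℤ → ℤ → Set
Admissible n d k m =
  (+ 1 - (+ 0 ⊓ d)) ≤ k × k ≤ m × m ≤ (+ n - (+ 0 ⊔ d))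

InM : (n : ℕ) → Mat n → Set
InM n A = (A ≈ 𝟘) ⊎ Σ ℤ (λ d → Σ ℤ (λ k → Σ ℤ (λ m → Admissible n d k m × A ≈ ⟨ d , k , m ⟩)))

𝟙 : {n : ℕ} → Mat n
𝟙 {n} = ⟨ + 0 , + 1 , + n ⟩

IsNoncommMonoid : (n : ℕ) → Set
IsNoncommMonoid n =
    (∀ A B → InM n A → InM n B → InM n (A ⊗ B))
  × InM n 𝟙
  × (∀ A → InM n A → ((𝟙 ⊗ A) ≈ A) × ((A ⊗ 𝟙) ≈ A))
  × (∀ A B C → InM n A → InM n B → InM n C → ((A ⊗ B) ⊗ C) ≈ (A ⊗ (B ⊗ C)))
  × Σ (Mat n) (λ A → Σ (Mat n) (λ B → InM n A × InM n B × ((A ⊗ B) ≈ (B ⊗ A) → Data.Empty.⊥)))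
  where import Data.Empty

module Submission where

open import Defs
open import Data.Nat using (ℕ; _≥_)
open import Data.Integer using (ℤ; +_; _+_; _-_; _⊓_; _⊔_; _≤_; _<_)
open import Data.Product using (_×_)

open import Data.Nat as ℕ using (zero; suc; s≤s; z≤n)
import Data.Nat.Properties as ℕ
open import Data.Integer using (-_; +≤+; _≤?_; _≟_)
open import Data.Integer.Properties
  using ( ≤-refl; ≤-reflexive; ≤-trans; <⇒≱; ≰⇒>; +-monoˡ-≤; +-monoʳ-≤; neg-mono-≤
        ; +-identityʳ; +-inverseʳ; +-injective; +-assoc; +-comm; module ≤-Reasoning
        ; i≤i⊔j; i≤j⊔i; i⊓j≤i; i⊓j≤j; ⊔-lub; ⊓-glb; i⊔j≤k⇒i≤k; i⊔j≤k⇒j≤k; i≤j⊓k⇒i≤j; i≤j⊓k⇒i≤k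
        ; antimono-≤-distrib-⊓; antimono-≤-distrib-⊔ )
open import Data.Integer.Tactic.RingSolver using (solve-∀)
open import Data.Fin using (Fin; fromℕ<)
import Data.Fin as Fin
open import Data.Fin.Properties using (toℕ-fromℕ<; toℕ-injective; toℕ<n; punchInᵢ≢i)
open import Data.Bool using (Bool; if_then_else_; _∧_)
open import Data.Product using (Σ; ∃-syntax; _,_; proj₁; proj₂)
open import Data.Product.Function.NonDependent.Propositional using (_×-⇔_)
open import Data.Sum using (inj₁; inj₂)
open import Function using (_∘_; _⇔_; mk⇔; Equivalence)
import Function.Properties.Equivalence as ⇔
open import Relation.Nullary using (Dec; yes; no; ¬_; does; _×-dec_)
open import Relation.Nullary.Decidable using (isYes≗does; dec-true; dec-false; does-⇔)
open import Relation.Binary.PropositionalEquality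
open import Algebra.Properties.Semiring.Sum ℕ.+-*-semiring
  using ( sum; sum-syntax; sum-cong-≗; sum-remove; sum-replicate-zero; ∑-comm
        ; *-distribˡ-sum; *-distribʳ-sum )

-- Row i of ⟨ d , k , m ⟩ is zero unless k ≤ i ≤ m, and then it is the unit row
-- vector at column i + d, which lies in 1..n by admissibility.  Hence row i of
-- ⟨ d , k , m ⟩ ⟨ d′ , k′ , m′ ⟩ is row i + d of ⟨ d′ , k′ , m′ ⟩; shifting
-- the conditions k′ ≤ i + d ≤ m′ and j − (i + d) = d′ back by d gives the block
-- ⟨ d + d′ , max(k , k′ − d) , min(m , m′ − d) ⟩.  Admissibility of ⟨ d , k , m ⟩
-- says exactly that the rows k..m and the columns k+d..m+d lie in 1..n, and in
-- this form the bounds on k″ and m″ are immediate.  Associativity is that of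
-- matrix multiplication, and E₁₂E₁₁ = 0 ≠ E₁₂ = E₁₁E₁₂ breaks commutativity.

private
  variable
    n : ℕ

sumFin≡sum : ∀ n (f : Fin n → ℕ) → sumFin n f ≡ sum f
sumFin≡sum zero    f = refl
sumFin≡sum (suc n) f = cong (f Fin.zero ℕ.+_) (sumFin≡sum n (f ∘ Fin.suc))

sum-zero : (f : Fin n → ℕ) → (∀ l → f l ≡ 0) → sum f ≡ 0
sum-zero {n} f f≡0 = trans (sum-cong-≗ f≡0) (sum-replicate-zero n)

sum-single : (f : Fin n → ℕ) (t : Fin n) → (∀ l → l ≢ t → f l ≡ 0) → sum f ≡ f t
sum-single {suc n} f t f≡0 = begin
  sum f                           ≡⟨ sum-remove {i = t} f ⟩
  f t ℕ.+ sum (f ∘ Fin.punchIn t) ≡⟨ cong (f t ℕ.+_) (sum-zero _ (λ l → f≡0 _ (punchInᵢ≢i t l))) ⟩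
  f t ℕ.+ 0                       ≡⟨ ℕ.+-identityʳ (f t) ⟩
  f t                             ∎
  where open ≡-Reasoning

⊗-entry : (A B : Mat n) (i j : Fin n) → (A ⊗ B) i j ≡ ∑[ l < n ] (A i l ℕ.* B l j)
⊗-entry {n} A B i j = sumFin≡sum n _

⊗-assoc : (A B C : Mat n) → ((A ⊗ B) ⊗ C) ≈ (A ⊗ (B ⊗ C))
⊗-assoc {n} A B C i j = begin
  ((A ⊗ B) ⊗ C) i j
    ≡⟨ ⊗-entry (A ⊗ B) C i j ⟩
  ∑[ l < n ] ((A ⊗ B) i l ℕ.* C l j)
    ≡⟨ sum-cong-≗ (λ l → cong (ℕ._* C l j) (⊗-entry A B i l)) ⟩
  ∑[ l < n ] (∑[ p < n ] (A i p ℕ.* B p l) ℕ.* C l j)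
    ≡⟨ sum-cong-≗ (λ l → *-distribʳ-sum (C l j) (λ p → A i p ℕ.* B p l)) ⟩
  ∑[ l < n ] (∑[ p < n ] (A i p ℕ.* B p l ℕ.* C l j))
    ≡⟨ ∑-comm (λ l p → A i p ℕ.* B p l ℕ.* C l j) ⟩
  ∑[ p < n ] (∑[ l < n ] (A i p ℕ.* B p l ℕ.* C l j))
    ≡⟨ sum-cong-≗ (λ p → sum-cong-≗ (λ l → ℕ.*-assoc (A i p) (B p l) (C l j))) ⟩
  ∑[ p < n ] (∑[ l < n ] (A i p ℕ.* (B p l ℕ.* C l j)))
    ≡⟨ sum-cong-≗ (λ p → *-distribˡ-sum (A i p) (λ l → B p l ℕ.* C l j)) ⟨
  ∑[ p < n ] (A i p ℕ.* ∑[ l < n ] (B p l ℕ.* C l j))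
    ≡⟨ sum-cong-≗ (λ p → cong (A i p ℕ.*_) (⊗-entry B C p j)) ⟨
  ∑[ p < n ] (A i p ℕ.* (B ⊗ C) p j)
    ≡⟨ ⊗-entry A (B ⊗ C) i j ⟨
  (A ⊗ (B ⊗ C)) i j
    ∎
  where open ≡-Reasoning

⊗-cong : {A A′ B B′ : Mat n} → A ≈ A′ → B ≈ B′ → (A ⊗ B) ≈ (A′ ⊗ B′)
⊗-cong {n} {A} {A′} {B} {B′} A≈A′ B≈B′ i j = begin
  (A ⊗ B) i j                    ≡⟨ ⊗-entry A B i j ⟩
  ∑[ l < n ] (A i l ℕ.* B l j)   ≡⟨ sum-cong-≗ (λ l → cong₂ ℕ._*_ (A≈A′ i l) (B≈B′ l j)) ⟩
  ∑[ l < n ] (A′ i l ℕ.* B′ l j) ≡⟨ ⊗-entry A′ B′ i j ⟨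
  (A′ ⊗ B′) i j                  ∎
  where open ≡-Reasoning

⊗-row-zero : (A B : Mat n) (i j : Fin n) → (∀ l → A i l ≡ 0) → (A ⊗ B) i j ≡ 0
⊗-row-zero A B i j row≡0 =
  trans (⊗-entry A B i j) (sum-zero _ (λ l → cong (ℕ._* B l j) (row≡0 l)))

⊗-col-zero : (A B : Mat n) (i j : Fin n) → (∀ l → B l j ≡ 0) → (A ⊗ B) i j ≡ 0
⊗-col-zero A B i j col≡0 =
  trans (⊗-entry A B i j) (sum-zero _ (λ l → trans (cong (A i l ℕ.*_) (col≡0 l)) (ℕ.*-zeroʳ (A i l))))

⊗-row-unit : (A B : Mat n) (i j t : Fin n) → A i t ≡ 1 → (∀ l → l ≢ t → A i l ≡ 0) →
             (A ⊗ B) i j ≡ B t j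
⊗-row-unit {n} A B i j t Ait≡1 row≡0 = begin
  (A ⊗ B) i j                  ≡⟨ ⊗-entry A B i j ⟩
  ∑[ l < n ] (A i l ℕ.* B l j) ≡⟨ sum-single _ t (λ l l≢t → cong (ℕ._* B l j) (row≡0 l l≢t)) ⟩
  A i t ℕ.* B t j              ≡⟨ cong (ℕ._* B t j) Ait≡1 ⟩
  1 ℕ.* B t j                  ≡⟨ ℕ.*-identityˡ (B t j) ⟩
  B t j                        ∎
  where open ≡-Reasoning

⊗-col-unit : (A B : Mat n) (i j t : Fin n) → B t j ≡ 1 → (∀ l → l ≢ t → B l j ≡ 0) →
             (A ⊗ B) i j ≡ A i t
⊗-col-unit {n} A B i j t Btj≡1 col≡0 = begin
  (A ⊗ B) i j                  ≡⟨ ⊗-entry A B i j ⟩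
  ∑[ l < n ] (A i l ℕ.* B l j) ≡⟨ sum-single _ t (λ l l≢t → A-col≡0 l (col≡0 l l≢t)) ⟩
  A i t ℕ.* B t j              ≡⟨ cong (A i t ℕ.*_) Btj≡1 ⟩
  A i t ℕ.* 1                  ≡⟨ ℕ.*-identityʳ (A i t) ⟩
  A i t                        ∎
  where
  open ≡-Reasoning
  A-col≡0 : ∀ l → B l j ≡ 0 → A i l ℕ.* B l j ≡ 0
  A-col≡0 l Blj≡0 = trans (cong (A i l ℕ.*_) Blj≡0) (ℕ.*-zeroʳ (A i l))

i+j-j≡i : ∀ i j → i + j - j ≡ i
i+j-j≡i = solve-∀

i-j+j≡i : ∀ i j → i - j + j ≡ i
i-j+j≡i = solve-∀

≤+⇔-≤ : ∀ a b d → (a ≤ b + d) ⇔ (a - d ≤ b)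
≤+⇔-≤ a b d = mk⇔
  (λ a≤b+d → ≤-trans (+-monoˡ-≤ (- d) a≤b+d) (≤-reflexive (i+j-j≡i b d)))
  (λ a-d≤b → ≤-trans (≤-reflexive (sym (i-j+j≡i a d))) (+-monoˡ-≤ d a-d≤b))

+≤⇔≤- : ∀ a b d → (a + d ≤ b) ⇔ (a ≤ b - d)
+≤⇔≤- a b d = mk⇔
  (λ a+d≤b → ≤-trans (≤-reflexive (sym (i+j-j≡i a d))) (+-monoˡ-≤ (- d) a+d≤b))
  (λ a≤b-d → ≤-trans (+-monoˡ-≤ d a≤b-d) (≤-reflexive (i-j+j≡i b d)))

⊔-≤⇔ : ∀ i j k → (i ⊔ j ≤ k) ⇔ (i ≤ k × j ≤ k)
⊔-≤⇔ i j k = mk⇔ (λ i⊔j≤k → i⊔j≤k⇒i≤k i j i⊔j≤k , i⊔j≤k⇒j≤k i j i⊔j≤k)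
                 (λ (i≤k , j≤k) → ⊔-lub i≤k j≤k)

≤-⊓⇔ : ∀ i j k → (i ≤ j ⊓ k) ⇔ (i ≤ j × i ≤ k)
≤-⊓⇔ i j k = mk⇔ (λ i≤j⊓k → i≤j⊓k⇒i≤j j k i≤j⊓k , i≤j⊓k⇒i≤k j k i≤j⊓k)
                 (λ (i≤j , i≤k) → ⊓-glb i≤j i≤k)

-≡⇔≡+ : ∀ y x d → (y - x ≡ d) ⇔ (y ≡ x + d)
-≡⇔≡+ y x d = mk⇔
  (λ y-x≡d → trans (sym (i-j+j≡i y x)) (trans (cong (_+ x) y-x≡d) (+-comm d x)))
  (λ y≡x+d → trans (cong (_- x) (trans y≡x+d (+-comm x d))) (i+j-j≡i d x))

-+≡⇔-≡+ : ∀ z x d d′ → (z - (x + d) ≡ d′) ⇔ (z - x ≡ d + d′)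
-+≡⇔-≡+ z x d d′ =
  ⇔.trans (-≡⇔≡+ z (x + d) d′)
          (⇔.trans (subst (λ w → (z ≡ x + d + d′) ⇔ (z ≡ w)) (+-assoc x d d′) ⇔.refl)
                   (⇔.sym (-≡⇔≡+ z x (d + d′))))

-‿antimonoʳ-≤ : ∀ c {x y} → x ≤ y → c - y ≤ c - x
-‿antimonoʳ-≤ c = +-monoʳ-≤ c ∘ neg-mono-≤

-- 1 − min(0 , d) = max(1 , 1 − d) and n − max(0 , d) = min(n , n − d).
lower-bound⇔ : ∀ d k → (+ 1 - (+ 0 ⊓ d) ≤ k) ⇔ (+ 1 ≤ k × + 1 ≤ k + d)
lower-bound⇔ d k rewrite antimono-≤-distrib-⊓ (-‿antimonoʳ-≤ (+ 1)) (+ 0) d =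
  ⇔.trans (⊔-≤⇔ (+ 1) (+ 1 - d) k) (⇔.refl ×-⇔ ⇔.sym (≤+⇔-≤ (+ 1) k d))

upper-bound⇔ : ∀ n d m → (m ≤ + n - (+ 0 ⊔ d)) ⇔ (m ≤ + n × m + d ≤ + n)
upper-bound⇔ n d m rewrite antimono-≤-distrib-⊔ (-‿antimonoʳ-≤ (+ n)) (+ 0) d | +-identityʳ (+ n) =
  ⇔.trans (≤-⊓⇔ m (+ n) (+ n - d)) (⇔.refl ×-⇔ ⇔.sym (+≤⇔≤- m (+ n) d))

-+-cancel : ∀ a d d′ → a - d + (d + d′) ≡ a + d′
-+-cancel = solve-∀

lower-bound-compose : ∀ {d k d′ k′} → + 1 - (+ 0 ⊓ d) ≤ k → + 1 - (+ 0 ⊓ d′) ≤ k′ →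
                      + 1 - (+ 0 ⊓ (d + d′)) ≤ k ⊔ (k′ - d)
lower-bound-compose {d} {k} {d′} {k′} lb lb′ =
  Equivalence.from (lower-bound⇔ (d + d′) (k ⊔ (k′ - d))) (≤-trans 1≤k (i≤i⊔j k (k′ - d)) , 1≤k″+d″)
  where
  open ≤-Reasoning
  1≤k = proj₁ (Equivalence.to (lower-bound⇔ d k) lb)
  1≤k″+d″ : + 1 ≤ k ⊔ (k′ - d) + (d + d′)
  1≤k″+d″ = begin
    + 1                     ≤⟨ proj₂ (Equivalence.to (lower-bound⇔ d′ k′) lb′) ⟩
    k′ + d′                 ≡⟨ -+-cancel k′ d d′ ⟨
    k′ - d + (d + d′)       ≤⟨ +-monoˡ-≤ (d + d′) (i≤j⊔i k (k′ - d)) ⟩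
    k ⊔ (k′ - d) + (d + d′) ∎

upper-bound-compose : ∀ {n d m d′ m′} → m ≤ + n - (+ 0 ⊔ d) → m′ ≤ + n - (+ 0 ⊔ d′) →
                      m ⊓ (m′ - d) ≤ + n - (+ 0 ⊔ (d + d′))
upper-bound-compose {n} {d} {m} {d′} {m′} ub ub′ =
  Equivalence.from (upper-bound⇔ n (d + d′) (m ⊓ (m′ - d))) (≤-trans (i⊓j≤i m (m′ - d)) m≤n , m″+d″≤n)
  where
  open ≤-Reasoning
  m≤n = proj₁ (Equivalence.to (upper-bound⇔ n d m) ub)
  m″+d″≤n : m ⊓ (m′ - d) + (d + d′) ≤ + n
  m″+d″≤n = begin
    m ⊓ (m′ - d) + (d + d′) ≤⟨ +-monoˡ-≤ (d + d′) (i⊓j≤j m (m′ - d)) ⟩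
    m′ - d + (d + d′)       ≡⟨ -+-cancel m′ d d′ ⟩
    m′ + d′                 ≤⟨ proj₂ (Equivalence.to (upper-bound⇔ n d′ m′) ub′) ⟩
    + n                     ∎

OnBlock : ℤ → ℤ → ℤ → ℤ → ℤ → Set
OnBlock d k m x y = k ≤ x × x ≤ m × y - x ≡ d

onBlock? : ∀ d k m x y → Dec (OnBlock d k m x y)
onBlock? d k m x y = k ≤? x ×-dec x ≤? m ×-dec y - x ≟ d

indicator : Bool → ℕ
indicator b = if b then 1 else 0

⟨⟩-entry : ∀ d k m (i j : Fin n) → ⟨ d , k , m ⟩ i j ≡ indicator (does (onBlock? d k m (idx i) (idx j)))
⟨⟩-entry d k m i j =
  cong indicator (cong₂ _∧_ (isYes≗does (k ≤? idx i))
                            (cong₂ _∧_ (isYes≗does (idx i ≤? m)) (isYes≗does (idx j - idx i ≟ d))))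

⟨⟩-on : ∀ d k m (i j : Fin n) → OnBlock d k m (idx i) (idx j) → ⟨ d , k , m ⟩ i j ≡ 1
⟨⟩-on d k m i j on =
  trans (⟨⟩-entry d k m i j) (cong indicator (dec-true (onBlock? d k m (idx i) (idx j)) on))

⟨⟩-off : ∀ d k m (i j : Fin n) → ¬ OnBlock d k m (idx i) (idx j) → ⟨ d , k , m ⟩ i j ≡ 0
⟨⟩-off d k m i j off =
  trans (⟨⟩-entry d k m i j) (cong indicator (dec-false (onBlock? d k m (idx i) (idx j)) off))

⟨⟩-cong : ∀ d k m d′ k′ m′ (i j i′ j′ : Fin n) →
          OnBlock d k m (idx i) (idx j) ⇔ OnBlock d′ k′ m′ (idx i′) (idx j′) →
          ⟨ d , k , m ⟩ i j ≡ ⟨ d′ , k′ , m′ ⟩ i′ j′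
⟨⟩-cong d k m d′ k′ m′ i j i′ j′ on⇔on′ = begin
  ⟨ d , k , m ⟩ i j      ≡⟨ ⟨⟩-entry d k m i j ⟩
  indicator (does on?)   ≡⟨ cong indicator (does-⇔ on⇔on′ on? on′?) ⟩
  indicator (does on′?)  ≡⟨ ⟨⟩-entry d′ k′ m′ i′ j′ ⟨
  ⟨ d′ , k′ , m′ ⟩ i′ j′ ∎
  where
  open ≡-Reasoning
  on?  = onBlock? d k m (idx i) (idx j)
  on′? = onBlock? d′ k′ m′ (idx i′) (idx j′)

⟨⟩-off-diagonal : ∀ d k m (i j : Fin n) → idx j ≢ idx i + d → ⟨ d , k , m ⟩ i j ≡ 0
⟨⟩-off-diagonal d k m i j j≢i+d =
  ⟨⟩-off d k m i j (λ (_ , _ , j-i≡d) → j≢i+d (Equivalence.to (-≡⇔≡+ (idx j) (idx i) d) j-i≡d))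

⟨⟩-empty : ∀ d k m → m < k → ⟨_,_,_⟩ {n} d k m ≈ 𝟘
⟨⟩-empty d k m m<k i j = ⟨⟩-off d k m i j (λ (k≤i , i≤m , _) → <⇒≱ m<k (≤-trans k≤i i≤m))

idx-injective : {i j : Fin n} → idx i ≡ idx j → i ≡ j
idx-injective = toℕ-injective ∘ ℕ.suc-injective ∘ +-injective

idx-surjective : ∀ {z} → + 1 ≤ z → z ≤ + n → ∃[ t ] idx {n} t ≡ z
idx-surjective {z = + zero}  (+≤+ ()) _
idx-surjective {z = + suc a} _ (+≤+ a<n) = fromℕ< a<n , cong (+_ ∘ suc) (toℕ-fromℕ< a<n)

column-in-range : ∀ d k m (i : Fin n) → Admissible n d k m → k ≤ idx i → idx i ≤ m →
                  ∃[ t ] idx t ≡ idx i + d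
column-in-range {n} d k m i (lb , _ , ub) k≤i i≤m = idx-surjective
  (≤-trans (proj₂ (Equivalence.to (lower-bound⇔ d k) lb)) (+-monoˡ-≤ d k≤i))
  (≤-trans (+-monoˡ-≤ d i≤m) (proj₂ (Equivalence.to (upper-bound⇔ n d m) ub)))

onBlock-compose : ∀ d k m d′ k′ m′ {x y z} → k ≤ x → x ≤ m → y ≡ x + d →
  OnBlock d′ k′ m′ y z ⇔ OnBlock (d + d′) (k ⊔ (k′ - d)) (m ⊓ (m′ - d)) x z
onBlock-compose d k m d′ k′ m′ {x} {z = z} k≤x x≤m refl = lower ×-⇔ upper ×-⇔ -+≡⇔-≡+ z x d d′
  where
  lower : (k′ ≤ x + d) ⇔ (k ⊔ (k′ - d) ≤ x)
  lower = mk⇔ (λ k′≤x+d → ⊔-lub k≤x (Equivalence.to (≤+⇔-≤ k′ x d) k′≤x+d))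
              (λ k″≤x → Equivalence.from (≤+⇔-≤ k′ x d) (i⊔j≤k⇒j≤k k (k′ - d) k″≤x))
  upper : (x + d ≤ m′) ⇔ (x ≤ m ⊓ (m′ - d))
  upper = mk⇔ (λ x+d≤m′ → ⊓-glb x≤m (Equivalence.to (+≤⇔≤- x m′ d) x+d≤m′))
              (λ x≤m″ → Equivalence.from (+≤⇔≤- x m′ d) (i≤j⊓k⇒i≤k m (m′ - d) x≤m″))

⟨⟩-⊗-⟨⟩ : ∀ d k m d′ k′ m′ → Admissible n d k m →
          (⟨_,_,_⟩ {n} d k m ⊗ ⟨ d′ , k′ , m′ ⟩) ≈ ⟨ d + d′ , k ⊔ (k′ - d) , m ⊓ (m′ - d) ⟩
⟨⟩-⊗-⟨⟩ d k m d′ k′ m′ adm i j with k ≤? idx i ×-dec idx i ≤? m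
... | no off-row = trans
  (⊗-row-zero ⟨ d , k , m ⟩ ⟨ d′ , k′ , m′ ⟩ i j
     (λ l → ⟨⟩-off d k m i l (λ (k≤i , i≤m , _) → off-row (k≤i , i≤m))))
  (sym (⟨⟩-off (d + d′) (k ⊔ (k′ - d)) (m ⊓ (m′ - d)) i j
     (λ (k″≤i , i≤m″ , _) → off-row (i⊔j≤k⇒i≤k k (k′ - d) k″≤i , i≤j⊓k⇒i≤j m (m′ - d) i≤m″))))
... | yes (k≤i , i≤m) with column-in-range d k m i adm k≤i i≤m
...   | t , t≡i+d = trans
  (⊗-row-unit ⟨ d , k , m ⟩ ⟨ d′ , k′ , m′ ⟩ i j t
     (⟨⟩-on d k m i t (k≤i , i≤m , Equivalence.from (-≡⇔≡+ (idx t) (idx i) d) t≡i+d))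
     (λ l l≢t → ⟨⟩-off-diagonal d k m i l (λ l≡i+d → l≢t (idx-injective (trans l≡i+d (sym t≡i+d))))))
  (⟨⟩-cong d′ k′ m′ (d + d′) (k ⊔ (k′ - d)) (m ⊓ (m′ - d)) t j i j
     (onBlock-compose d k m d′ k′ m′ {z = idx j} k≤i i≤m t≡i+d))

𝟙-diagonal : ∀ (i : Fin n) → 𝟙 i i ≡ 1
𝟙-diagonal {n} i =
  ⟨⟩-on (+ 0) (+ 1) (+ n) i i (+≤+ (s≤s z≤n) , +≤+ (toℕ<n i) , +-inverseʳ (idx i))

𝟙-off-diagonal : ∀ (i j : Fin n) → i ≢ j → 𝟙 i j ≡ 0
𝟙-off-diagonal {n} i j i≢j = ⟨⟩-off-diagonal (+ 0) (+ 1) (+ n) i j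
  (λ j≡i+0 → i≢j (idx-injective (sym (trans j≡i+0 (+-identityʳ (idx i))))))

⊗-identityˡ : (A : Mat n) → (𝟙 ⊗ A) ≈ A
⊗-identityˡ A i j = ⊗-row-unit 𝟙 A i j i (𝟙-diagonal i) (λ l l≢i → 𝟙-off-diagonal i l (l≢i ∘ sym))

⊗-identityʳ : (A : Mat n) → (A ⊗ 𝟙) ≈ A
⊗-identityʳ A i j = ⊗-col-unit A 𝟙 i j j (𝟙-diagonal j) (λ l l≢j → 𝟙-off-diagonal l j l≢j)

𝟙-admissible : Admissible (suc n) (+ 0) (+ 1) (+ suc n)
𝟙-admissible {n} = ≤-refl , +≤+ (s≤s z≤n) , ≤-reflexive (sym (+-identityʳ (+ suc n)))

InM-resp-≈ : {A B : Mat n} → A ≈ B → InM n B → InM n A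
InM-resp-≈ A≈B (inj₁ B≈𝟘) = inj₁ (λ i j → trans (A≈B i j) (B≈𝟘 i j))
InM-resp-≈ A≈B (inj₂ (d , k , m , adm , B≈⟨⟩)) =
  inj₂ (d , k , m , adm , λ i j → trans (A≈B i j) (B≈⟨⟩ i j))

⟨⟩-⊗-⟨⟩∈M : ∀ d k m d′ k′ m′ → Admissible n d k m → Admissible n d′ k′ m′ →
            InM n (⟨ d , k , m ⟩ ⊗ ⟨ d′ , k′ , m′ ⟩)
⟨⟩-⊗-⟨⟩∈M d k m d′ k′ m′ adm@(lb , _ , ub) (lb′ , _ , ub′) with k ⊔ (k′ - d) ≤? m ⊓ (m′ - d)
... | yes k″≤m″ =
  inj₂ ( _ , _ , _
       , (lower-bound-compose lb lb′ , k″≤m″ , upper-bound-compose ub ub′)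
       , ⟨⟩-⊗-⟨⟩ d k m d′ k′ m′ adm )
... | no k″≰m″ =
  inj₁ (λ i j → trans (⟨⟩-⊗-⟨⟩ d k m d′ k′ m′ adm i j) (⟨⟩-empty _ _ _ (≰⇒> k″≰m″) i j))

⊗-closed : (A B : Mat n) → InM n A → InM n B → InM n (A ⊗ B)
⊗-closed A B (inj₁ A≈𝟘) _ = inj₁ (λ i j → ⊗-row-zero A B i j (A≈𝟘 i))
⊗-closed A B (inj₂ _) (inj₁ B≈𝟘) = inj₁ (λ i j → ⊗-col-zero A B i j (λ l → B≈𝟘 l j))
⊗-closed A B (inj₂ (d , k , m , adm , A≈)) (inj₂ (d′ , k′ , m′ , adm′ , B≈)) =
  InM-resp-≈ (⊗-cong A≈ B≈) (⟨⟩-⊗-⟨⟩∈M d k m d′ k′ m′ adm adm′)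

M-noncommutative : ∀ n → Σ (Mat (suc (suc n))) λ A → Σ (Mat (suc (suc n))) λ B →
                   InM (suc (suc n)) A × InM (suc (suc n)) B × ¬ (A ⊗ B) ≈ (B ⊗ A)
M-noncommutative n =
  E₁₂ , E₁₁ ,
  inj₂ (_ , _ , _ , E₁₂-admissible , λ _ _ → refl) ,
  inj₂ (_ , _ , _ , E₁₁-admissible , λ _ _ → refl) ,
  λ E₁₂E₁₁≈E₁₁E₁₂ → ℕ.0≢1+n (begin
    0                 ≡⟨ ⟨⟩-⊗-⟨⟩ (+ 1) (+ 1) (+ 1) (+ 0) (+ 1) (+ 1) E₁₂-admissible 0F 1F ⟨
    (E₁₂ ⊗ E₁₁) 0F 1F ≡⟨ E₁₂E₁₁≈E₁₁E₁₂ 0F 1F ⟩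
    (E₁₁ ⊗ E₁₂) 0F 1F ≡⟨ ⟨⟩-⊗-⟨⟩ (+ 0) (+ 1) (+ 1) (+ 1) (+ 1) (+ 1) E₁₁-admissible 0F 1F ⟩
    1                 ∎)
  where
  open ≡-Reasoning
  0F 1F : Fin (suc (suc n))
  0F = Fin.zero
  1F = Fin.suc Fin.zero
  E₁₂ E₁₁ : Mat (suc (suc n))
  E₁₂ = ⟨ + 1 , + 1 , + 1 ⟩
  E₁₁ = ⟨ + 0 , + 1 , + 1 ⟩
  E₁₂-admissible : Admissible (suc (suc n)) (+ 1) (+ 1) (+ 1)
  E₁₂-admissible = ≤-refl , ≤-refl , +≤+ (s≤s z≤n)
  E₁₁-admissible : Admissible (suc (suc n)) (+ 0) (+ 1) (+ 1)
  E₁₁-admissible = ≤-refl , ≤-refl , +≤+ (s≤s z≤n)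

M-isNoncommMonoid : ∀ n → IsNoncommMonoid (suc (suc n))
M-isNoncommMonoid n =
  ⊗-closed ,
  inj₂ (_ , _ , _ , 𝟙-admissible , λ _ _ → refl) ,
  (λ A _ → ⊗-identityˡ A , ⊗-identityʳ A) ,
  (λ A B C _ _ _ → ⊗-assoc A B C) ,
  M-noncommutative n

theorem3 : (n : ℕ) → n ≥ 2 →
  IsNoncommMonoid n
  × (∀ d k m d′ k′ m′ → Admissible n d k m → Admissible n d′ k′ m′ →
       let d″ = d + d′
           k″ = k ⊔ (k′ - d)
           m″ = m ⊓ (m′ - d)
       in (k″ ≤ m″ → (⟨_,_,_⟩ {n} d k m ⊗ ⟨ d′ , k′ , m′ ⟩) ≈ ⟨ d″ , k″ , m″ ⟩)
        × (m″ < k″ → (⟨_,_,_⟩ {n} d k m ⊗ ⟨ d′ , k′ , m′ ⟩) ≈ 𝟘 {n})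
        × ((+ 1 - (+ 0 ⊓ d″)) ≤ k″)
        × (m″ ≤ (+ n - (+ 0 ⊔ d″))))
theorem3 (suc (suc n)) (s≤s (s≤s _)) =
  M-isNoncommMonoid n ,
  λ d k m d′ k′ m′ adm@(lb , _ , ub) (lb′ , _ , ub′) →
    let product = ⟨⟩-⊗-⟨⟩ d k m d′ k′ m′ adm in
    (λ _ → product) ,
    (λ m″<k″ i j → trans (product i j) (⟨⟩-empty _ _ _ m″<k″ i j)) ,
    lower-bound-compose lb lb′ ,
    upper-bound-compose ub ub′
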